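{- For every $n\ge 1$, Snort played on the (initially uncoloured, untinted) graph $G_n$ is a first player win, where $G_n$ is obtained from $T_{n,3}$ by adding three new vertices $R_2, R_3, R_3'$ and the edges $(n,1)\sim R_2$, $(n,2)\sim R_2$, $(n,2)\sim R_3$, $(n,3)\sim R_3$, $R_2\sim R_3$, $R_2\sim R_3'$, $R_3\sim R_3'$.
   Context: Snort is a two-player game (players Left and Right) played on a finite simple graph. The players alternately colour a previously uncoloured vertex, Left in blue and Right in red, subject to the rule that no two adjacent vertices may receive opposite colours. Normal play: a player who cannot move on their turn loses. A game is a "first player win" if the player who moves first has a winning strategy, regardless of whether that player is Left or Right. $T_{n,3}$ is the graph with vertex set $\{(i,j): 1\le i\le n,\ 1\le j\le 3\}$ and edges $(i,j)\sim(i+1,j)$ for $1\le i\le n-1$, $1\le j\le 3$; $(i,j)\sim(i,j+1)$ for $1\le i\le n$, $1\le j\le 2$; and $(i,j)\sim(i+1,j+1)$ for $1\le i\le n-1$, $1\le j\le 2$. -}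

module Defs where

open import Data.Nat using (ℕ; suc)
open import Data.Fin using (Fin; toℕ)
open import Data.Maybe using (Maybe; just; nothing)
open import Data.Sum using (_⊎_)
open import Data.Product using (_×_)
open import Relation.Nullary using (¬_; Dec; yes; no)
open import Relation.Binary.PropositionalEquality using (_≡_; _≢_)

record Graph : Set₁ where
  field
    V    : Set
    _≟_  : (x y : V) → Dec (x ≡ y)
    Adj  : V → V → Set

-- Players: Left colours blue, Right colours red.
data Player : Set where
  Left Right : Player

opp : Player → Player
opp Left  = Right
opp Right = Left

module Snort (G : Graph) where
  open Graph G

  Position : Set
  Position = V → Maybe Player

  start : Position
  start _ = nothing

  Legal : Player → Position → V → Set
  Legal p c v = (c v ≡ nothing) × (∀ w → Adj v w → c w ≢ just (opp p))

  play : Position → V → Player → Position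
  play c v p w with w ≟ v
  ... | yes _ = just p
  ... | no  _ = c w

  -- Normal play.
  data Wins  (p : Player) (c : Position) : Set
  data Loses (p : Player) (c : Position) : Set

  data Wins p c where
    win : (v : V) → Legal p c v → Loses (opp p) (play c v p) → Wins p c

  data Loses p c where
    lose : (∀ v → Legal p c v → Wins (opp p) (play c v p)) → Loses p c

  FirstPlayerWin : Position → Set
  FirstPlayerWin c = Wins Left c × Wins Right c

-- The graph G_n : T_{n,3} plus vertices R₂, R₃, R₃′.
-- Grid vertex (i,j) of the paper is  grid i j  with 0-based i : Fin n, j : Fin 3.

data GV (n : ℕ) : Set where
  grid : Fin n → Fin 3 → GV n
  R₂ R₃ R₃′ : GV n

_≟GV_ : ∀ {n} (x y : GV n) → Dec (x ≡ y)
grid i j ≟GV grid i′ j′ with i Data.Fin.≟ i′ | j Data.Fin.≟ j′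
... | yes Relation.Binary.PropositionalEquality.refl | yes Relation.Binary.PropositionalEquality.refl = yes Relation.Binary.PropositionalEquality.refl
... | no ¬p | _ = no λ { Relation.Binary.PropositionalEquality.refl → ¬p Relation.Binary.PropositionalEquality.refl }
... | yes _ | no ¬q = no λ { Relation.Binary.PropositionalEquality.refl → ¬q Relation.Binary.PropositionalEquality.refl }
grid _ _ ≟GV R₂  = no λ ()
grid _ _ ≟GV R₃  = no λ ()
grid _ _ ≟GV R₃′ = no λ ()
R₂  ≟GV grid _ _ = no λ ()
R₂  ≟GV R₂  = yes Relation.Binary.PropositionalEquality.refl
R₂  ≟GV R₃  = no λ ()
R₂  ≟GV R₃′ = no λ ()
R₃  ≟GV grid _ _ = no λ ()
R₃  ≟GV R₂  = no λ ()
R₃  ≟GV R₃  = yes Relation.Binary.PropositionalEquality.refl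
R₃  ≟GV R₃′ = no λ ()
R₃′ ≟GV grid _ _ = no λ ()
R₃′ ≟GV R₂  = no λ ()
R₃′ ≟GV R₃  = no λ ()
R₃′ ≟GV R₃′ = yes Relation.Binary.PropositionalEquality.refl

-- One orientation of each edge of G_n.
data Edge (n : ℕ) : GV n → GV n → Set where
  down  : ∀ {i i′ j} → toℕ i′ ≡ suc (toℕ i) → Edge n (grid i j) (grid i′ j)
  right : ∀ {i j j′} → toℕ j′ ≡ suc (toℕ j) → Edge n (grid i j) (grid i j′)
  diag  : ∀ {i i′ j j′} → toℕ i′ ≡ suc (toℕ i) → toℕ j′ ≡ suc (toℕ j)
        → Edge n (grid i j) (grid i′ j′)
  -- extra edges; the last row is the i with toℕ i + 1 ≡ n
  -- (n,1)~R₂, (n,2)~R₂, (n,2)~R₃, (n,3)~R₃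
  n1R₂  : ∀ {i} → suc (toℕ i) ≡ n → Edge n (grid i Data.Fin.zero) R₂
  n2R₂  : ∀ {i} → suc (toℕ i) ≡ n → Edge n (grid i (Data.Fin.suc Data.Fin.zero)) R₂
  n2R₃  : ∀ {i} → suc (toℕ i) ≡ n → Edge n (grid i (Data.Fin.suc Data.Fin.zero)) R₃
  n3R₃  : ∀ {i} → suc (toℕ i) ≡ n → Edge n (grid i (Data.Fin.suc (Data.Fin.suc Data.Fin.zero))) R₃
  R₂R₃  : Edge n R₂ R₃
  R₂R₃′ : Edge n R₂ R₃′
  R₃R₃′ : Edge n R₃ R₃′

G : ℕ → Graph
G n = record { V = GV n ; _≟_ = _≟GV_ ; Adj = λ x y → Edge n x y ⊎ Edge n y x }

-- In skew coordinates the vertex (i , j) of T_{n,3} sits in row i - 1 of column j - 1, and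
-- R₂, R₃, R₃′ extend columns 1 and 2 to rows n, n and n + 1, so column j has j + n cells.
-- Reversing every column, (r , j) ↦ (j + n - 1 - r , j), is then an automorphism σ of G_n.
-- The first player colours the centre (⌊n/2⌋ , 1) and answers every move at v by colouring
-- σ v.  The cells whose mirror image is themselves or a vertical neighbour lie in the closed
-- neighbourhood of the centre, so the opponent can never colour them; every other vertex has
-- a distinct, non-adjacent partner, the position stays colour-reversed symmetric on these,
-- and so the mirror move is always legal.

module Submission where

open import Defs
open import Data.Nat using (ℕ; suc; _+_; _∸_; _≤_; _<_; _≥_; _≤?_; _<?_; z≤n; s≤s; ⌊_/2⌋; ⌈_/2⌉)
open import Data.Nat.Properties
  using ( ≤-refl; ≤-reflexive; ≤-trans; ≤-antisym; ≤-pred; <⇒≤; <-irrefl; <-asym; <-trans; <-≤-trans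
        ; ≮⇒≥; n≤1+n; n<1+n; m≤n⇒m≤1+n; m≤n⇒m<n∨m≡n; m≤n+m; suc-injective
        ; +-suc; +-comm; +-identityʳ; +-mono-≤; +-mono-≤-<; +-monoʳ-≤
        ; n∸n≡0; m+n∸n≡m; m+n∸m≡n; m+[n∸m]≡n; m∸[m∸n]≡n; m∸n≤m; +-∸-assoc; ∸-monoˡ-<
        ; ⌊n/2⌋-mono; ⌈n/2⌉-mono; ⌊n/2⌋≤⌈n/2⌉; ⌊n/2⌋+⌈n/2⌉≡n; ⌊n/2⌋<n; n≡⌊n+n/2⌋; n≡⌈n+n/2⌉ )
open import Data.Nat.Induction using (<-wellFounded)
open import Induction.WellFounded using (Acc; acc)
open import Data.Fin using (Fin; toℕ; fromℕ<)
open import Data.Fin.Properties using (toℕ<n; toℕ-fromℕ<; fromℕ<-toℕ; toℕ-injective)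
open import Data.Maybe using (Maybe; just; nothing)
import Data.Maybe as Maybe
open import Data.Maybe.Properties using (just-injective)
open import Data.List using (List; []; _∷_; cartesianProductWith; allFin)
open import Data.List.Membership.Propositional using (_∈_)
open import Data.List.Membership.Propositional.Properties using (∈-cartesianProductWith⁺; ∈-allFin)
open import Data.List.Relation.Unary.Any using (here; there)
open import Data.Product using (_×_; _,_; proj₁; ∃)
import Data.Product as Product
open import Data.Sum using (_⊎_; inj₁; inj₂)
import Data.Sum as Sum
open import Relation.Nullary using (¬_; ¬?; yes; no; contradiction)
open import Relation.Nullary.Decidable using (_×-dec_; decidable-stable)
open import Relation.Unary using (Decidable)
open import Relation.Binary.PropositionalEquality

opp-involutive : ∀ p → opp (opp p) ≡ p
opp-involutive Left  = refl
opp-involutive Right = refl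

opp-≢ : ∀ p → opp p ≢ p
opp-≢ Left  ()
opp-≢ Right ()

module SnortProperties (Γ : Graph) where
  open Graph Γ
  open Snort Γ

  play-at : ∀ c v p → play c v p v ≡ just p
  play-at c v p with v ≟ v
  ... | yes _   = refl
  ... | no v≢v = contradiction refl v≢v

  play-elsewhere : ∀ c v p {w} → w ≢ v → play c v p w ≡ c w
  play-elsewhere c v p {w} w≢v with w ≟ v
  ... | yes w≡v = contradiction w≡v w≢v
  ... | no _    = refl

  play-keeps-colour : ∀ c v p {w s} → c v ≡ nothing → c w ≡ just s → play c v p w ≡ just s
  play-keeps-colour c v p {w} cv≡nothing cw≡s with w ≟ v
  ... | yes refl = contradiction (trans (sym cv≡nothing) cw≡s) λ ()
  ... | no _     = cw≡s

  blank : Maybe Player → ℕ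
  blank nothing  = 1
  blank (just _) = 0

  uncoloured : List V → Position → ℕ
  uncoloured []       c = 0
  uncoloured (w ∷ ws) c = blank (c w) + uncoloured ws c

  blank-play : ∀ c v p w → blank (play c v p w) ≤ blank (c w)
  blank-play c v p w with w ≟ v
  ... | yes _ = z≤n
  ... | no _  = ≤-refl

  uncoloured-play-≤ : ∀ ws c v p → uncoloured ws (play c v p) ≤ uncoloured ws c
  uncoloured-play-≤ []       c v p = z≤n
  uncoloured-play-≤ (w ∷ ws) c v p = +-mono-≤ (blank-play c v p w) (uncoloured-play-≤ ws c v p)

  uncoloured-play-< : ∀ {ws c v} p → c v ≡ nothing → v ∈ ws →
                      uncoloured ws (play c v p) < uncoloured ws c
  uncoloured-play-< {w ∷ ws} {c} {v} p cv≡nothing (here refl)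
    rewrite play-at c v p | cv≡nothing = s≤s (uncoloured-play-≤ ws c v p)
  uncoloured-play-< {w ∷ ws} {c} {v} p cv≡nothing (there v∈ws) =
    +-mono-≤-< (blank-play c v p w) (uncoloured-play-< p cv≡nothing v∈ws)

module MirrorStrategy
  (Γ : Graph)
  (vertices : List (Graph.V Γ)) (∈-vertices : ∀ v → v ∈ vertices)
  (σ : Graph.V Γ → Graph.V Γ) (σ-involutive : ∀ v → σ (σ v) ≡ v)
  (Paired : Graph.V Γ → Set) (Paired? : Decidable Paired)
  (σ-paired : ∀ {v} → Paired v → Paired (σ v))
  (σ-≢ : ∀ {v} → Paired v → σ v ≢ v)
  (σ-nonadjacent : ∀ {v} → Paired v → ¬ Graph.Adj Γ (σ v) v)
  (σ-adjacent : ∀ {u v} → Paired u → Paired v → Graph.Adj Γ u v → Graph.Adj Γ (σ u) (σ v))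
  where
  open Graph Γ
  open Snort Γ
  open SnortProperties Γ

  Symmetric : Position → Set
  Symmetric c = ∀ v → Paired v → c (σ v) ≡ Maybe.map opp (c v)

  Claimed : Player → Position → V → Set
  Claimed p c v = c v ≡ just p ⊎ ∃ λ w → Adj v w × c w ≡ just p

  Denied : Player → Position → V → Set
  Denied q c v = c v ≢ just q × Claimed (opp q) c v

  Invariant : Player → Position → Set
  Invariant q c = Symmetric c × (∀ v → ¬ Paired v → Denied q c v)

  σ-injective : ∀ {u v} → σ u ≡ σ v → u ≡ v
  σ-injective {u} {v} σu≡σv = trans (sym (σ-involutive u)) (trans (cong σ σu≡σv) (σ-involutive v))

  denied-illegal : ∀ {q c v} → Denied q c v → ¬ Legal q c v
  denied-illegal (_ , inj₁ cv≡opp) (cv≡nothing , _) = contradiction (trans (sym cv≡nothing) cv≡opp) λ ()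
  denied-illegal (_ , inj₂ (w , v~w , cw≡opp)) (_ , free) = free w v~w cw≡opp

  claimed-play : ∀ {p c a v} r → c a ≡ nothing → v ≢ a → Claimed p c v → Claimed p (play c a r) v
  claimed-play {c = c} {a} r ca≡nothing v≢a (inj₁ cv≡p) = inj₁ (trans (play-elsewhere c a r v≢a) cv≡p)
  claimed-play {c = c} {a} r ca≡nothing v≢a (inj₂ (w , v~w , cw≡p)) =
    inj₂ (w , v~w , play-keeps-colour c a r ca≡nothing cw≡p)

  denied-play : ∀ {q c a v} r → Paired a → c a ≡ nothing → ¬ Paired v →
                Denied q c v → Denied q (play c a r) v
  denied-play {q} {c} {a} {v} r Pa ca≡nothing ¬Pv (cv≢q , claimed) =
    subst (_≢ just q) (sym (play-elsewhere c a r v≢a)) cv≢q , claimed-play r ca≡nothing v≢a claimed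
    where
    v≢a : v ≢ a
    v≢a refl = ¬Pv Pa

  legal-paired : ∀ {q c x} → Invariant q c → Legal q c x → Paired x
  legal-paired {x = x} (_ , denied) legal with Paired? x
  ... | yes Px  = Px
  ... | no ¬Px = contradiction legal (denied-illegal (denied x ¬Px))

  mirror-legal : ∀ {q c x} → Invariant q c → Legal q c x → Legal (opp q) (play c x q) (σ x)
  mirror-legal {q} {c} {x} inv@(symmetric , denied) legal@(cx≡nothing , free) =
    mirror-free , mirror-unblocked
    where
    Px : Paired x
    Px = legal-paired inv legal
    mirror-free : play c x q (σ x) ≡ nothing
    mirror-free = begin
      play c x q (σ x)    ≡⟨ play-elsewhere c x q (σ-≢ Px) ⟩
      c (σ x)             ≡⟨ symmetric x Px ⟩
      Maybe.map opp (c x) ≡⟨ cong (Maybe.map opp) cx≡nothing ⟩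
      nothing             ∎
      where open ≡-Reasoning
    no-q-neighbour : ∀ w → Adj (σ x) w → c w ≢ just q
    no-q-neighbour w σx~w cw≡q with Paired? w
    ... | yes Pw = free (σ w) x~σw (trans (symmetric w Pw) (cong (Maybe.map opp) cw≡q))
      where
      x~σw : Adj x (σ w)
      x~σw = subst (λ u → Adj u (σ w)) (σ-involutive x) (σ-adjacent (σ-paired Px) Pw σx~w)
    ... | no ¬Pw = proj₁ (denied w ¬Pw) cw≡q
    mirror-unblocked : ∀ w → Adj (σ x) w → play c x q w ≢ just (opp (opp q))
    -- Splitting on w ≟ x instead would also abstract the test inside play c x q w in c′w≡q.
    mirror-unblocked w σx~w c′w≡q with x ≟ w
    ... | yes refl = σ-nonadjacent Px σx~w
    ... | no x≢w   = no-q-neighbour w σx~w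
      (trans (sym (play-elsewhere c x q (≢-sym x≢w))) (trans c′w≡q (cong just (opp-involutive q))))

  module _ {c : Position} {x : V} (q : Player) (Px : Paired x) where
    private
      c′ c″ : Position
      c′ = play c x q
      c″ = play c′ (σ x) (opp q)

      c″x≡q : c″ x ≡ just q
      c″x≡q = trans (play-elsewhere c′ (σ x) (opp q) (≢-sym (σ-≢ Px))) (play-at c x q)

      unplayed : ∀ w → w ≢ x → w ≢ σ x → c″ w ≡ c w
      unplayed w w≢x w≢σx = trans (play-elsewhere c′ (σ x) (opp q) w≢σx) (play-elsewhere c x q w≢x)

    mirror-symmetric : Symmetric c → Symmetric (play (play c x q) (σ x) (opp q))
    mirror-symmetric symmetric y Py with x ≟ y | σ x ≟ y
    ... | yes refl | _ = begin
      c″ (σ x)                 ≡⟨ play-at c′ (σ x) (opp q) ⟩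
      just (opp q)             ≡⟨ cong (Maybe.map opp) (sym c″x≡q) ⟩
      Maybe.map opp (c″ x)     ∎
      where open ≡-Reasoning
    ... | no _ | yes refl = begin
      c″ (σ (σ x))             ≡⟨ cong c″ (σ-involutive x) ⟩
      c″ x                     ≡⟨ c″x≡q ⟩
      just q                   ≡⟨ cong just (sym (opp-involutive q)) ⟩
      just (opp (opp q))       ≡⟨ cong (Maybe.map opp) (sym (play-at c′ (σ x) (opp q))) ⟩
      Maybe.map opp (c″ (σ x)) ∎
      where open ≡-Reasoning
    ... | no x≢y | no σx≢y = begin
      c″ (σ y)                 ≡⟨ unplayed (σ y) σy≢x σy≢σx ⟩
      c (σ y)                  ≡⟨ symmetric y Py ⟩
      Maybe.map opp (c y)      ≡⟨ cong (Maybe.map opp) (sym (unplayed y (≢-sym x≢y) (≢-sym σx≢y))) ⟩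
      Maybe.map opp (c″ y)     ∎
      where
      open ≡-Reasoning
      σy≢x : σ y ≢ x
      σy≢x refl = σx≢y (σ-involutive y)
      σy≢σx : σ y ≢ σ x
      σy≢σx σy≡σx = x≢y (σ-injective (sym σy≡σx))

  mirror-invariant : ∀ {q c x} → Invariant q c → Legal q c x →
                     Invariant q (play (play c x q) (σ x) (opp q))
  mirror-invariant {q} {c} {x} inv@(symmetric , denied) legal@(cx≡nothing , _) =
    mirror-symmetric q Px symmetric ,
    λ v ¬Pv → denied-play (opp q) (σ-paired Px) (proj₁ (mirror-legal inv legal)) ¬Pv
                (denied-play q Px cx≡nothing ¬Pv (denied v ¬Pv))
    where
    Px : Paired x
    Px = legal-paired inv legal

  mirror-loses-acc : ∀ q c → Acc _<_ (uncoloured vertices c) → Invariant q c → Loses q c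
  mirror-loses-acc q c (acc smaller) inv = lose reply
    where
    reply : ∀ x → Legal q c x → Wins (opp q) (play c x q)
    reply x legal@(cx≡nothing , _) =
      win (σ x) legal′ (subst (λ r → Loses r c″) (sym (opp-involutive q))
        (mirror-loses-acc q c″ (smaller fewer) (mirror-invariant inv legal)))
      where
      c″ : Position
      c″ = play (play c x q) (σ x) (opp q)
      legal′ : Legal (opp q) (play c x q) (σ x)
      legal′ = mirror-legal inv legal
      fewer : uncoloured vertices c″ < uncoloured vertices c
      fewer = <-trans (uncoloured-play-< (opp q) (proj₁ legal′) (∈-vertices (σ x)))
                      (uncoloured-play-< q cx≡nothing (∈-vertices x))

  mirror-loses : ∀ q c → Invariant q c → Loses q c
  mirror-loses q c = mirror-loses-acc q c (<-wellFounded _)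

  module _ {x₀ : V} (¬Px₀ : ¬ Paired x₀) (near-x₀ : ∀ v → ¬ Paired v → v ≡ x₀ ⊎ Adj v x₀) where

    opening-invariant : ∀ q → Invariant q (play start x₀ (opp q))
    opening-invariant q = symmetric , denied
      where
      c₁ : Position
      c₁ = play start x₀ (opp q)
      c₁x₀ : c₁ x₀ ≡ just (opp q)
      c₁x₀ = play-at start x₀ (opp q)
      unplayed : ∀ {v} → v ≢ x₀ → c₁ v ≡ nothing
      unplayed = play-elsewhere start x₀ (opp q)
      paired-unplayed : ∀ {v} → Paired v → c₁ v ≡ nothing
      paired-unplayed Pv = unplayed λ { refl → ¬Px₀ Pv }
      symmetric : Symmetric c₁
      symmetric v Pv = trans (paired-unplayed (σ-paired Pv)) (cong (Maybe.map opp) (sym (paired-unplayed Pv)))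
      denied : ∀ v → ¬ Paired v → Denied q c₁ v
      denied v ¬Pv with x₀ ≟ v
      ... | yes refl = (λ c₁x₀≡q → opp-≢ q (just-injective (trans (sym c₁x₀) c₁x₀≡q))) , inj₁ c₁x₀
      ... | no x₀≢v  = (λ c₁v≡q → contradiction (trans (sym (unplayed (≢-sym x₀≢v))) c₁v≡q) λ ())
                     , inj₂ (x₀ , adjacent (near-x₀ v ¬Pv) , c₁x₀)
        where
        adjacent : v ≡ x₀ ⊎ Adj v x₀ → Adj v x₀
        adjacent (inj₁ v≡x₀) = contradiction (sym v≡x₀) x₀≢v
        adjacent (inj₂ v~x₀) = v~x₀

    first-player-wins : FirstPlayerWin start
    first-player-wins =
      win x₀ opening-legal (mirror-loses Right _ (opening-invariant Right)) ,
      win x₀ opening-legal (mirror-loses Left _ (opening-invariant Left))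
      where
      opening-legal : ∀ {p} → Legal p start x₀
      opening-legal = refl , λ _ _ ()

between : ∀ {m k} → m ≤ k → k ≤ suc m → k ≡ m ⊎ k ≡ suc m
between m≤k k≤1+m with m≤n⇒m<n∨m≡n k≤1+m
... | inj₁ k<1+m = inj₁ (≤-antisym (≤-pred k<1+m) m≤k)
... | inj₂ k≡1+m = inj₂ k≡1+m

⌈n/2⌉≤1+⌊n/2⌋ : ∀ n → ⌈ n /2⌉ ≤ suc ⌊ n /2⌋
⌈n/2⌉≤1+⌊n/2⌋ n = ⌊n/2⌋-mono (n≤1+n (suc n))

WithinOne : ℕ → ℕ → Set
WithinOne a b = a ≤ suc b × b ≤ suc a

within-≡ : ∀ {a b} → a ≡ b → WithinOne a b
within-≡ refl = n≤1+n _ , n≤1+n _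

within-suc : ∀ {a b} → b ≡ suc a → WithinOne a b
within-suc {a} refl = m≤n⇒m≤1+n (n≤1+n a) , ≤-refl

Cell : Set
Cell = ℕ × ℕ

data Step : Cell → Cell → Set where
  down  : ∀ {r j r′ j′} → r′ ≡ suc r → j′ ≡ j     → Step (r , j) (r′ , j′)
  right : ∀ {r j r′ j′} → r′ ≡ r     → j′ ≡ suc j → Step (r , j) (r′ , j′)
  diag  : ∀ {r j r′ j′} → r′ ≡ suc r → j′ ≡ suc j → Step (r , j) (r′ , j′)

Neighbours : Cell → Cell → Set
Neighbours a b = Step a b ⊎ Step b a

step-increases : ∀ {r j r′ j′} → Step (r , j) (r′ , j′) → r + j < r′ + j′
step-increases         (down  refl refl) = ≤-refl
step-increases {r} {j} (right refl refl) = ≤-reflexive (sym (+-suc r j))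
step-increases {r} {j} (diag  refl refl) = s≤s (+-monoʳ-≤ r (n≤1+n j))

step-irreflexive : ∀ {a} → ¬ Step a a
step-irreflexive {_ , _} s = <-irrefl refl (step-increases s)

step-asymmetric : ∀ {a b} → Step a b → ¬ Step b a
step-asymmetric {_ , _} {_ , _} s t = <-asym (step-increases s) (step-increases t)

same-column-step : ∀ {r r′ j} → Step (r , j) (r′ , j) → r′ ≡ suc r
same-column-step (down e _) = e
same-column-step (right _ ())
same-column-step (diag _ ())

module Geometry (n : ℕ) where
  open Graph (G n) using (Adj)

  -- j + n rather than n + j, so that the column length computes for a literal column j.
  InShape : Cell → Set
  InShape (r , j) = j < 3 × r < j + n

  cell : GV n → Cell
  cell (grid i j) = toℕ i , toℕ j
  cell R₂  = n , 1
  cell R₃  = n , 2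
  cell R₃′ = suc n , 2

  cell-inShape : ∀ x → InShape (cell x)
  cell-inShape (grid i j) = toℕ<n j , ≤-trans (toℕ<n i) (m≤n+m n (toℕ j))
  cell-inShape R₂  = s≤s (s≤s z≤n) , ≤-refl
  cell-inShape R₃  = s≤s (s≤s (s≤s z≤n)) , n≤1+n (suc n)
  cell-inShape R₃′ = s≤s (s≤s (s≤s z≤n)) , ≤-refl

  column : ℕ → Fin 3
  column 0 = Fin.zero
  column 1 = Fin.suc Fin.zero
  column _ = Fin.suc (Fin.suc Fin.zero)

  toℕ-column : ∀ {j} → j < 3 → toℕ (column j) ≡ j
  toℕ-column {0} _ = refl
  toℕ-column {1} _ = refl
  toℕ-column {2} _ = refl
  toℕ-column {suc (suc (suc _))} (s≤s (s≤s (s≤s ())))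

  column-toℕ : ∀ j → column (toℕ j) ≡ j
  column-toℕ Fin.zero                    = refl
  column-toℕ (Fin.suc Fin.zero)          = refl
  column-toℕ (Fin.suc (Fin.suc Fin.zero)) = refl

  -- The vertex in row n + d of column j, with R₂ as junk value outside the shape.
  beyond : ℕ → ℕ → GV n
  beyond 0 2 = R₃
  beyond 1 2 = R₃′
  beyond _ _ = R₂

  vertexAt : Cell → GV n
  vertexAt (r , j) with r <? n
  ... | yes r<n = grid (fromℕ< r<n) (column j)
  ... | no _    = beyond (r ∸ n) j

  vertexAt-cell : ∀ x → vertexAt (cell x) ≡ x
  vertexAt-cell (grid i j) with toℕ i <? n
  ... | yes i<n = cong₂ grid (fromℕ<-toℕ i i<n) (column-toℕ j)
  ... | no i≮n  = contradiction (toℕ<n i) i≮n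
  vertexAt-cell R₂ with n <? n
  ... | yes n<n = contradiction n<n (<-irrefl refl)
  ... | no _    = cong (λ d → beyond d 1) (n∸n≡0 n)
  vertexAt-cell R₃ with n <? n
  ... | yes n<n = contradiction n<n (<-irrefl refl)
  ... | no _    = cong (λ d → beyond d 2) (n∸n≡0 n)
  vertexAt-cell R₃′ with suc n <? n
  ... | yes 1+n<n = contradiction 1+n<n (<-asym (n<1+n n))
  ... | no _      = cong (λ d → beyond d 2) (m+n∸n≡m 1 n)

  cell-beyond : ∀ d j → d < j → j < 3 → cell (beyond d j) ≡ (n + d , j)
  cell-beyond 0 1 _ _ = cong (_, 1) (sym (+-identityʳ n))
  cell-beyond 0 2 _ _ = cong (_, 2) (sym (+-identityʳ n))
  cell-beyond 1 2 _ _ = cong (_, 2) (+-comm 1 n)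
  cell-beyond (suc _) 1 (s≤s ()) _
  cell-beyond (suc (suc _)) 2 (s≤s (s≤s ())) _
  cell-beyond _ (suc (suc (suc _))) _ (s≤s (s≤s (s≤s ())))

  cell-vertexAt : ∀ {p} → InShape p → cell (vertexAt p) ≡ p
  cell-vertexAt {r , j} (j<3 , r<j+n) with r <? n
  ... | yes r<n = cong₂ _,_ (toℕ-fromℕ< r<n) (toℕ-column j<3)
  ... | no r≮n  = trans (cell-beyond (r ∸ n) j r∸n<j j<3) (cong (_, j) (m+[n∸m]≡n n≤r))
    where
    n≤r : n ≤ r
    n≤r = ≮⇒≥ r≮n
    r∸n<j : r ∸ n < j
    r∸n<j = subst (r ∸ n <_) (m+n∸n≡m j n) (∸-monoˡ-< r<j+n n≤r)

  cell-injective : ∀ {x y} → cell x ≡ cell y → x ≡ y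
  cell-injective {x} {y} e = trans (sym (vertexAt-cell x)) (trans (cong vertexAt e) (vertexAt-cell y))

  edge-step : ∀ {x y} → Edge n x y → Step (cell x) (cell y)
  edge-step (down e)    = down e refl
  edge-step (right e)   = right refl e
  edge-step (diag e e′) = diag e e′
  edge-step (n1R₂ e)    = diag (sym e) refl
  edge-step (n2R₂ e)    = down (sym e) refl
  edge-step (n2R₃ e)    = diag (sym e) refl
  edge-step (n3R₃ e)    = down (sym e) refl
  edge-step R₂R₃        = right refl refl
  edge-step R₂R₃′       = diag refl refl
  edge-step R₃R₃′       = down refl refl

  row-overflow : ∀ {m} (i : Fin n) → n ≤ m → toℕ i ≢ m
  row-overflow i n≤m refl = <-irrefl refl (<-≤-trans (toℕ<n i) n≤m)

  no-step-back-to-grid : ∀ {r k l} (i : Fin n) → n ≤ r → ¬ Step (r , k) (toℕ i , l)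
  no-step-back-to-grid i n≤r (down e _)  = row-overflow i (m≤n⇒m≤1+n n≤r) e
  no-step-back-to-grid i n≤r (right e _) = row-overflow i n≤r e
  no-step-back-to-grid i n≤r (diag e _)  = row-overflow i (m≤n⇒m≤1+n n≤r) e

  step-edge : ∀ x y → Step (cell x) (cell y) → Edge n x y
  step-edge (grid i j) (grid i′ j′) (down e e′) rewrite toℕ-injective e′ = down e
  step-edge (grid i j) (grid i′ j′) (right e e′) rewrite toℕ-injective e = right e′
  step-edge (grid i j) (grid i′ j′) (diag e e′) = diag e e′
  step-edge (grid i j) R₂ (down e e′)
    rewrite toℕ-injective {i = j} {j = Fin.suc Fin.zero} (sym e′) = n2R₂ (sym e)
  step-edge (grid i j) R₂ (right e _) = contradiction (sym e) (row-overflow i ≤-refl)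
  step-edge (grid i j) R₂ (diag e e′)
    rewrite toℕ-injective {i = j} {j = Fin.zero} (suc-injective (sym e′)) = n1R₂ (sym e)
  step-edge (grid i j) R₃ (down e e′)
    rewrite toℕ-injective {i = j} {j = Fin.suc (Fin.suc Fin.zero)} (sym e′) = n3R₃ (sym e)
  step-edge (grid i j) R₃ (right e _) = contradiction (sym e) (row-overflow i ≤-refl)
  step-edge (grid i j) R₃ (diag e e′)
    rewrite toℕ-injective {i = j} {j = Fin.suc Fin.zero} (suc-injective (sym e′)) = n2R₃ (sym e)
  step-edge (grid i j) R₃′ (down e _)  = contradiction (suc-injective (sym e)) (row-overflow i ≤-refl)
  step-edge (grid i j) R₃′ (right e _) = contradiction (sym e) (row-overflow i (n≤1+n n))
  step-edge (grid i j) R₃′ (diag e _)  = contradiction (suc-injective (sym e)) (row-overflow i ≤-refl)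
  step-edge R₂  (grid i j) s = contradiction s (no-step-back-to-grid i ≤-refl)
  step-edge R₃  (grid i j) s = contradiction s (no-step-back-to-grid i ≤-refl)
  step-edge R₃′ (grid i j) s = contradiction s (no-step-back-to-grid i (n≤1+n n))
  step-edge R₂  R₃  _ = R₂R₃
  step-edge R₂  R₃′ _ = R₂R₃′
  step-edge R₃  R₃′ _ = R₃R₃′
  step-edge R₃  R₂  s = contradiction s (step-asymmetric (edge-step R₂R₃))
  step-edge R₃′ R₂  s = contradiction s (step-asymmetric (edge-step R₂R₃′))
  step-edge R₃′ R₃  s = contradiction s (step-asymmetric (edge-step R₃R₃′))
  step-edge R₂  R₂  s = contradiction s step-irreflexive
  step-edge R₃  R₃  s = contradiction s step-irreflexive
  step-edge R₃′ R₃′ s = contradiction s step-irreflexive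

  adj-neighbours : ∀ {x y} → Adj x y → Neighbours (cell x) (cell y)
  adj-neighbours = Sum.map edge-step edge-step

  neighbours-adj : ∀ x y → Neighbours (cell x) (cell y) → Adj x y
  neighbours-adj x y = Sum.map (step-edge x y) (step-edge y x)

  reflect : Cell → Cell
  reflect (r , j) = j + n ∸ suc r , j

  ∸≡suc∸suc : ∀ {m r} → r < m → m ∸ r ≡ suc (m ∸ suc r)
  ∸≡suc∸suc r<m = +-∸-assoc 1 r<m

  reflect-inShape : ∀ {p} → InShape p → InShape (reflect p)
  reflect-inShape {r , j} (j<3 , r<j+n) =
    j<3 , subst (_≤ j + n) (∸≡suc∸suc r<j+n) (m∸n≤m (j + n) r)

  reflect-involutive : ∀ {p} → InShape p → reflect (reflect p) ≡ p
  reflect-involutive {r , j} (_ , r<j+n) = cong (_, j) (begin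
    j + n ∸ suc (j + n ∸ suc r) ≡⟨ cong (j + n ∸_) (sym (∸≡suc∸suc r<j+n)) ⟩
    j + n ∸ (j + n ∸ r)         ≡⟨ m∸[m∸n]≡n (<⇒≤ r<j+n) ⟩
    r                           ∎)
    where open ≡-Reasoning

  reflect-step : ∀ {p q} → InShape p → InShape q → Step p q → Neighbours (reflect p) (reflect q)
  reflect-step _             (_ , r+1<j+n) (down  refl refl) = inj₂ (down (∸≡suc∸suc r+1<j+n) refl)
  reflect-step (_ , r<j+n)   _             (right refl refl) = inj₁ (diag (∸≡suc∸suc r<j+n) refl)
  reflect-step _             _             (diag  refl refl) = inj₁ (right refl refl)

  reflect-neighbours : ∀ {p q} → InShape p → InShape q → Neighbours p q → Neighbours (reflect p) (reflect q)
  reflect-neighbours sp sq (inj₁ s) = reflect-step sp sq s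
  reflect-neighbours sp sq (inj₂ s) = Sum.swap (reflect-step sq sp s)

  σ : GV n → GV n
  σ x = vertexAt (reflect (cell x))

  cell-σ : ∀ x → cell (σ x) ≡ reflect (cell x)
  cell-σ x = cell-vertexAt (reflect-inShape (cell-inShape x))

  σ-involutive : ∀ x → σ (σ x) ≡ x
  σ-involutive x = cell-injective (begin
    cell (σ (σ x))            ≡⟨ cell-σ (σ x) ⟩
    reflect (cell (σ x))      ≡⟨ cong reflect (cell-σ x) ⟩
    reflect (reflect (cell x)) ≡⟨ reflect-involutive (cell-inShape x) ⟩
    cell x                    ∎)
    where open ≡-Reasoning

  σ-adjacent : ∀ {x y} → Adj x y → Adj (σ x) (σ y)
  σ-adjacent {x} {y} x~y = neighbours-adj (σ x) (σ y)
    (subst₂ Neighbours (sym (cell-σ x)) (sym (cell-σ y))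
      (reflect-neighbours (cell-inShape x) (cell-inShape y) (adj-neighbours x~y)))

  NearAxis : Cell → Set
  NearAxis p = WithinOne (proj₁ p) (proj₁ (reflect p))

  nearAxis? : Decidable NearAxis
  nearAxis? (r , j) = (r ≤? suc (j + n ∸ suc r)) ×-dec (j + n ∸ suc r ≤? suc r)

  nearAxis-reflect : ∀ {p} → InShape p → NearAxis (reflect p) → NearAxis p
  nearAxis-reflect sp near = Product.swap (subst (WithinOne _) (cong proj₁ (reflect-involutive sp)) near)

  neighbour-of-reflection-nearAxis : ∀ {p} → Neighbours (reflect p) p → NearAxis p
  neighbour-of-reflection-nearAxis (inj₁ s) = Product.swap (within-suc (same-column-step s))
  neighbour-of-reflection-nearAxis (inj₂ s) = within-suc (same-column-step s)

  Paired : GV n → Set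
  Paired x = ¬ NearAxis (cell x)

  paired? : Decidable Paired
  paired? x = ¬? (nearAxis? (cell x))

  σ-paired : ∀ {x} → Paired x → Paired (σ x)
  σ-paired {x} Px near = Px (nearAxis-reflect (cell-inShape x) (subst NearAxis (cell-σ x) near))

  σ-≢ : ∀ {x} → Paired x → σ x ≢ x
  σ-≢ {x} Px σx≡x = Px (within-≡ (sym (cong proj₁ (trans (sym (cell-σ x)) (cong cell σx≡x)))))

  σ-nonadjacent : ∀ {x} → Paired x → ¬ Adj (σ x) x
  σ-nonadjacent {x} Px σx~x = Px (neighbour-of-reflection-nearAxis
    (subst (λ c → Neighbours c (cell x)) (cell-σ x) (adj-neighbours σx~x)))

  nearAxis-halves : ∀ {r j} → InShape (r , j) → NearAxis (r , j) →
                    r ≤ ⌊ j + n /2⌋ × ⌈ j + n /2⌉ ≤ suc r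
  nearAxis-halves {r} {j} (_ , r<m) (r≤1+r′ , r′≤1+r) =
    subst (_≤ ⌊ m /2⌋) (sym (n≡⌊n+n/2⌋ r)) (⌊n/2⌋-mono 2r≤m) ,
    subst (⌈ m /2⌉ ≤_) (sym (n≡⌈n+n/2⌉ (suc r))) (⌈n/2⌉-mono m≤2r+2)
    where
    m r′ : ℕ
    m  = j + n
    r′ = m ∸ suc r
    m≡1+r+r′ : suc (r + r′) ≡ m
    m≡1+r+r′ = m+[n∸m]≡n r<m
    2r≤m : r + r ≤ m
    2r≤m = ≤-trans (+-monoʳ-≤ r r≤1+r′) (≤-reflexive (trans (+-suc r r′) m≡1+r+r′))
    m≤2r+2 : m ≤ suc r + suc r
    m≤2r+2 = ≤-trans (≤-reflexive (sym m≡1+r+r′)) (s≤s (+-monoʳ-≤ r r′≤1+r))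

  nearAxis-around-centre : ∀ {p} → InShape p → NearAxis p →
                           p ≡ (⌊ n /2⌋ , 1) ⊎ Neighbours p (⌊ n /2⌋ , 1)
  nearAxis-around-centre {r , 0} sp near with nearAxis-halves sp near
  ... | r≤h , ⌈⌉≤1+r with between r≤h (≤-trans (⌊n/2⌋≤⌈n/2⌉ n) ⌈⌉≤1+r)
  ...   | inj₁ h≡r   = inj₂ (inj₁ (right h≡r refl))
  ...   | inj₂ h≡1+r = inj₂ (inj₁ (diag h≡1+r refl))
  nearAxis-around-centre {r , 1} sp near with nearAxis-halves sp near
  ... | r≤⌈⌉ , 1+h≤1+r with between (≤-pred 1+h≤1+r) (≤-trans r≤⌈⌉ (⌈n/2⌉≤1+⌊n/2⌋ n))
  ...   | inj₁ r≡h   = inj₁ (cong (_, 1) r≡h)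
  ...   | inj₂ r≡1+h = inj₂ (inj₂ (down r≡1+h refl))
  nearAxis-around-centre {r , 2} sp near with nearAxis-halves sp near
  ... | r≤1+h , 1+⌈⌉≤1+r with between (≤-trans (⌊n/2⌋≤⌈n/2⌉ n) (≤-pred 1+⌈⌉≤1+r)) r≤1+h
  ...   | inj₁ r≡h   = inj₂ (inj₂ (right r≡h refl))
  ...   | inj₂ r≡1+h = inj₂ (inj₂ (diag r≡1+h refl))
  nearAxis-around-centre {_ , suc (suc (suc _))} (s≤s (s≤s (s≤s ())) , _) _

  centre-nearAxis : NearAxis (⌊ n /2⌋ , 1)
  centre-nearAxis = subst (WithinOne ⌊ n /2⌋) (sym n∸h≡⌈⌉)
    (m≤n⇒m≤1+n (⌊n/2⌋≤⌈n/2⌉ n) , ⌈n/2⌉≤1+⌊n/2⌋ n)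
    where
    n∸h≡⌈⌉ : n ∸ ⌊ n /2⌋ ≡ ⌈ n /2⌉
    n∸h≡⌈⌉ = trans (cong (_∸ ⌊ n /2⌋) (sym (⌊n/2⌋+⌈n/2⌉≡n n))) (m+n∸m≡n ⌊ n /2⌋ ⌈ n /2⌉)

  module _ (h<n : ⌊ n /2⌋ < n) where

    centre : GV n
    centre = grid (fromℕ< h<n) (Fin.suc Fin.zero)

    cell-centre : cell centre ≡ (⌊ n /2⌋ , 1)
    cell-centre = cong (_, 1) (toℕ-fromℕ< h<n)

    centre-unpaired : ¬ Paired centre
    centre-unpaired Pc = Pc (subst NearAxis (sym cell-centre) centre-nearAxis)

    unpaired-near-centre : ∀ x → ¬ Paired x → x ≡ centre ⊎ Adj x centre
    unpaired-near-centre x ¬Px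
      with nearAxis-around-centre (cell-inShape x) (decidable-stable (nearAxis? (cell x)) ¬Px)
    ... | inj₁ at-centre = inj₁ (cell-injective (trans at-centre (sym cell-centre)))
    ... | inj₂ next      = inj₂ (neighbours-adj x centre (subst (Neighbours (cell x)) (sym cell-centre) next))

  vertices : List (GV n)
  vertices = R₂ ∷ R₃ ∷ R₃′ ∷ cartesianProductWith grid (allFin n) (allFin 3)

  ∈-vertices : ∀ x → x ∈ vertices
  ∈-vertices (grid i j) = there (there (there (∈-cartesianProductWith⁺ grid (∈-allFin i) (∈-allFin j))))
  ∈-vertices R₂  = here refl
  ∈-vertices R₃  = there (here refl)
  ∈-vertices R₃′ = there (there (here refl))

lemma3p5 : (n : ℕ) → n ≥ 1 → Snort.FirstPlayerWin (G n) (Snort.start (G n))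
lemma3p5 (suc m) _ =
  MirrorStrategy.first-player-wins (G n) vertices ∈-vertices σ σ-involutive
    Paired paired? (λ {x} → σ-paired {x}) (λ {x} → σ-≢ {x}) (λ {x} → σ-nonadjacent {x})
    (λ _ _ → σ-adjacent)
    (centre-unpaired h<n) (unpaired-near-centre h<n)
  where
  n : ℕ
  n = suc m
  open Geometry n
  h<n : ⌊ n /2⌋ < n
  h<n = ⌊n/2⌋<n m
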